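{- Let $a,b,c,d\in\mathbb{Z}$ with $abc\neq 0$ and $a\leq b\leq c$, let $\mathcal{L}_3$ denote the inequality $ax+by+cz+d<0$, and set $\sigma=a+b+c+d$. If $\mathcal{L}_3$ has a solution in the positive integers, then \[R(\mathcal{L}_3,2)=R(\mathcal{L}_3,\mathbb{Z}/3\mathbb{Z})=\begin{cases} 1 & \text{if } \sigma<0,\\[4pt] \left\lfloor \frac{d}{ -a-b-c}\right\rfloor+1 & \text{if } \sigma\geq 0 \text{ and } a\leq b\leq c<0,\\[4pt] \left\lfloor \frac{c\left(\left\lfloor \frac{c+d}{ -a-b}\right\rfloor+1\right)+d}{ -a-b}\right\rfloor+1 & \text{if } \sigma\geq 0 \text{ and } a\leq b<0<c,\\[4pt] \left\lfloor \frac{(b+c)\left(\left\lfloor \frac{b+c+d}{ -a}\right\rfloor+1\right)+d}{ -a}\right\rfloor+1 & \text{if } \sigma\geq 0 \text{ and } a<0<b\leq c. \end{cases}\]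
   Context: For integers $a\le b$, $[a,b]=\{x\in\mathbb{N}: a\le x\le b\}$ and $[a,b]^3$ is the set of triples with entries in $[a,b]$. An $r$-coloring of $[1,n]$ is a function $\chi:[1,n]\to\{0,1,\dots,r-1\}$. For an inequality (or equation) $\mathcal{L}$ in three variables $x,y,z$, a solution $(x_1,x_2,x_3)\in[1,n]^3$ is monochromatic if $\chi(x_1)=\chi(x_2)=\chi(x_3)$, and zero-sum (for $r=3$) if $\chi(x_1)+\chi(x_2)+\chi(x_3)\equiv 0 \pmod 3$. $R(\mathcal{L},2)$ is the smallest positive integer $N$ (if it exists) such that for every $n\ge N$ and every $2$-coloring of $[1,n]$ there is a monochromatic solution of $\mathcal{L}$ in $[1,n]^3$. $R(\mathcal{L},\mathbb{Z}/3\mathbb{Z})$ is the smallest positive integer $N$ (if it exists) such that for every $n\ge N$ and every map $\chi:[1,n]\to\{0,1,2\}$ there is a zero-sum solution of $\mathcal{L}$ in $[1,n]^3$. -}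

module Defs where

open import Data.Nat using (ℕ; suc; _≤_; _%_)
open import Data.Integer as ℤ using (ℤ; +_; _/ℕ_)
open import Data.Fin using (Fin; toℕ)
open import Data.Product using (Σ; _×_)
open import Relation.Binary.PropositionalEquality using (_≡_)

L3 : (a b c d : ℤ) → ℕ → ℕ → ℕ → Set
L3 a b c d x y z = a ℤ.* + x ℤ.+ b ℤ.* + y ℤ.+ c ℤ.* + z ℤ.+ d ℤ.< + 0

InRange : ℕ → ℕ → Set
InRange n x = 1 ≤ x × x ≤ n

-- Every 2-coloring of [1,n] has a monochromatic solution of L3 in [1,n]^3.
-- (A coloring is given as a map on ℕ; only its restriction to [1,n] matters.)
MonoProp : (a b c d : ℤ) → ℕ → Set
MonoProp a b c d n = (χ : ℕ → Fin 2) →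
  Σ ℕ λ x → Σ ℕ λ y → Σ ℕ λ z →
    InRange n x × InRange n y × InRange n z × L3 a b c d x y z ×
    χ x ≡ χ y × χ y ≡ χ z

ZeroSumProp : (a b c d : ℤ) → ℕ → Set
ZeroSumProp a b c d n = (χ : ℕ → Fin 3) →
  Σ ℕ λ x → Σ ℕ λ y → Σ ℕ λ z →
    InRange n x × InRange n y × InRange n z × L3 a b c d x y z ×
    (toℕ (χ x) Data.Nat.+ toℕ (χ y) Data.Nat.+ toℕ (χ z)) % 3 ≡ 0

IsRamsey : (ℕ → Set) → ℕ → Set
IsRamsey P N =
  1 ≤ N × ((n : ℕ) → N ≤ n → P n) ×
  ((M : ℕ) → 1 ≤ M → ((n : ℕ) → M ≤ n → P n) → N ≤ M)

-- floor(i / j) for j > 0 (junk value 0 when j ≤ 0; only used with j > 0).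
floorDiv : ℤ → ℤ → ℤ
floorDiv i (+ suc k) = i /ℕ suc k
floorDiv i _ = + 0

-- Colour [1, m) with 0 and [m, n] with 1: a monochromatic solution must lie in [1, m)³ or in
-- [m, n]³, so if neither box contains a solution both numbers exceed n. Conversely, suppose
-- 1 ≤ m ≤ M are such that (M, m, 1) is a solution and each of the pairs {M, m}, {m, 1}, {M, 1}
-- carries a solution using only its two points. Then a 3-colouring either repeats a colour on
-- one of these pairs, giving a monochromatic (hence zero-sum) solution, or uses three distinct
-- colours on M, m, 1, whose sum is 0 + 1 + 2. A zero-sum solution of a colouring with values
-- in {0, 1} is monochromatic, so both numbers equal M.
--
-- Since a x + b y + c z + d is monotone in every variable, the boxes and the points are found
-- along the lines (t, t, t), (t, t, u) and (t, u, u), on which the form is e(u) − s t for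
-- s = −(sum of the negative coefficients): m is the least t with e(1) − s t < 0, i.e.
-- ⌊e(1)/s⌋ + 1, and M the least t with e(m) − s t < 0. When c < 0 the single point
-- m = M = ⌊d/s⌋ + 1 suffices, and when σ < 0 the point 1 does. If a, b, c > 0 and σ ≥ 0
-- there is no solution at all; this is the only use of the solvability hypothesis.
module Submission where

open import Defs
open import Data.Nat using (ℕ; _≤_)
open import Data.Integer using (ℤ; +_; _+_; _-_; _*_; -_; _<_)
open import Data.Product using (Σ; _×_)
open import Relation.Binary.PropositionalEquality using (_≡_; _≢_)

open import Data.Bool using (Bool; true; false; if_then_else_)
open import Data.Empty using (⊥-elim)
open import Data.Fin using (Fin; zero; suc; toℕ; inject₁; _≟_)
open import Data.Fin.Properties using (all?; 0≢1+n)
open import Data.Integer as ℤ using (-[1+_]; +≤+; +<+; _/ℕ_)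
import Data.Integer.Properties as ℤ
open import Data.Integer.DivMod using ([n/ℕd]*d≤n; n<s[n/ℕd]*d; 0≤n⇒0≤n/ℕd)
open import Data.Integer.Tactic.RingSolver using (solve-∀)
import Data.Nat as ℕ
import Data.Nat.Properties as ℕ
open import Data.Nat.DivMod using (_%_; m*n%n≡0)
import Data.Nat.Tactic.RingSolver as ℕ-Solver
open import Data.Product using (_,_)
open import Data.Sum using (_⊎_; inj₁; inj₂; [_,_]′)
open import Function using (_∘_; const)
open import Relation.Nullary using (¬_; yes; no; contradiction)
open import Relation.Nullary.Decidable using (from-yes; _⊎-dec_; _×-dec_; _→-dec_)
open import Relation.Binary.PropositionalEquality
  using (refl; sym; trans; cong; subst; module ≡-Reasoning)

-- Colourings and Ramsey numbers of an arbitrary set of triples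

Triples : Set₁
Triples = ℕ → ℕ → ℕ → Set

MonoSolution : Triples → ℕ → (ℕ → Fin 2) → Set
MonoSolution S n χ = Σ ℕ λ x → Σ ℕ λ y → Σ ℕ λ z →
  InRange n x × InRange n y × InRange n z × S x y z × χ x ≡ χ y × χ y ≡ χ z

ColourSum≡0 : ∀ {k} → Fin k → Fin k → Fin k → Set
ColourSum≡0 p q r = (toℕ p ℕ.+ toℕ q ℕ.+ toℕ r) % 3 ≡ 0

ZeroSumSolution : Triples → ℕ → (ℕ → Fin 3) → Set
ZeroSumSolution S n χ = Σ ℕ λ x → Σ ℕ λ y → Σ ℕ λ z →
  InRange n x × InRange n y × InRange n z × S x y z × ColourSum≡0 (χ x) (χ y) (χ z)

MonoFor : Triples → ℕ → Set
MonoFor S n = ∀ χ → MonoSolution S n χ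

ZeroSumFor : Triples → ℕ → Set
ZeroSumFor S n = ∀ χ → ZeroSumSolution S n χ

BothRamsey : Triples → ℕ → Set
BothRamsey S N = IsRamsey (MonoFor S) N × IsRamsey (ZeroSumFor S) N

pigeonhole₃ : (p q r : Fin 3) → p ≡ q ⊎ q ≡ r ⊎ p ≡ r ⊎ ColourSum≡0 p q r
pigeonhole₃ = from-yes (all? λ (p : Fin 3) → all? λ (q : Fin 3) → all? λ (r : Fin 3) →
  p ≟ q ⊎-dec q ≟ r ⊎-dec p ≟ r ⊎-dec (toℕ p ℕ.+ toℕ q ℕ.+ toℕ r) % 3 ℕ.≟ 0)

zeroSum-binary : (p q r : Fin 2) →
  ColourSum≡0 (inject₁ p) (inject₁ q) (inject₁ r) → p ≡ q × q ≡ r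
zeroSum-binary = from-yes (all? λ (p : Fin 2) → all? λ (q : Fin 2) → all? λ (r : Fin 2) →
  (toℕ (inject₁ p) ℕ.+ toℕ (inject₁ q) ℕ.+ toℕ (inject₁ r)) % 3 ℕ.≟ 0 →-dec
  p ≟ q ×-dec q ≟ r)

triple-sum : ∀ k → (k ℕ.+ k ℕ.+ k) % 3 ≡ 0
triple-sum k = trans (cong (_% 3) (k+k+k≡k*3 k)) (m*n%n≡0 k 3)
  where
  k+k+k≡k*3 : ∀ k → k ℕ.+ k ℕ.+ k ≡ k ℕ.* 3
  k+k+k≡k*3 = ℕ-Solver.solve-∀

zeroSum⇒mono : ∀ {S n} → ZeroSumFor S n → MonoFor S n
zeroSum⇒mono zs χ with zs (inject₁ ∘ χ)
... | x , y , z , rx , ry , rz , s , sum≡0 =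
  x , y , z , rx , ry , rz , s , zeroSum-binary (χ x) (χ y) (χ z) sum≡0

SolutionFree : Triples → ℕ → ℕ → Set
SolutionFree S lo hi = ∀ {x y z} → lo ≤ x → lo ≤ y → lo ≤ z →
  x ℕ.< hi → y ℕ.< hi → z ℕ.< hi → ¬ S x y z

solutionFree-empty : ∀ S k → SolutionFree S k k
solutionFree-empty _ k k≤x _ _ x<k _ _ _ = ℕ.<-irrefl refl (ℕ.≤-<-trans k≤x x<k)

threshold : ℕ → ℕ → Fin 2
threshold m x = [ const zero , const (suc zero) ]′ (ℕ.<-≤-connex x m)

threshold-monochromatic : ∀ m {x y z} →
  threshold m x ≡ threshold m y → threshold m y ≡ threshold m z →
  (x ℕ.< m × y ℕ.< m × z ℕ.< m) ⊎ (m ≤ x × m ≤ y × m ≤ z)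
threshold-monochromatic m {x} {y} {z} χx≡χy χy≡χz
  with ℕ.<-≤-connex x m | ℕ.<-≤-connex y m | ℕ.<-≤-connex z m
... | inj₁ x<m | inj₁ y<m | inj₁ z<m = inj₁ (x<m , y<m , z<m)
... | inj₂ m≤x | inj₂ m≤y | inj₂ m≤z = inj₂ (m≤x , m≤y , m≤z)
... | inj₁ _ | inj₂ _ | _ = ⊥-elim (0≢1+n χx≡χy)
... | inj₂ _ | inj₁ _ | _ = ⊥-elim (0≢1+n (sym χx≡χy))
... | inj₁ _ | inj₁ _ | inj₂ _ = ⊥-elim (0≢1+n χy≡χz)
... | inj₂ _ | inj₂ _ | inj₁ _ = ⊥-elim (0≢1+n (sym χy≡χz))

no-mono-below : ∀ {S m M n} → SolutionFree S 1 m → SolutionFree S m M → n ℕ.< M →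
  ¬ MonoFor S n
no-mono-below {m = m} {M} {n} free₁ free₂ n<M mono with mono (threshold m)
... | x , y , z , rx@(1≤x , _) , ry@(1≤y , _) , rz@(1≤z , _) , s , χx≡χy , χy≡χz
  with threshold-monochromatic m χx≡χy χy≡χz
... | inj₁ (x<m , y<m , z<m) = free₁ 1≤x 1≤y 1≤z x<m y<m z<m s
... | inj₂ (m≤x , m≤y , m≤z) = free₂ m≤x m≤y m≤z (<M rx) (<M ry) (<M rz) s
  where
  <M : ∀ {k} → InRange n k → k ℕ.< M
  <M (_ , k≤n) = ℕ.≤-<-trans k≤n n<M

OnPair : Triples → ℕ → ℕ → Set
OnPair S u v = Σ (Bool × Bool × Bool) λ (i , j , k) → S (pick i) (pick j) (pick k)
  where
  pick : Bool → ℕ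
  pick b = if b then u else v

record Covering (S : Triples) (u v w : ℕ) : Set where
  field
    on-uv : OnPair S u v
    on-vw : OnPair S v w
    on-uw : OnPair S u w
    uvw   : S u v w

covering-diagonal : ∀ {S u} → S u u u → Covering S u u u
covering-diagonal s = record { on-uv = diagonal ; on-vw = diagonal ; on-uw = diagonal ; uvw = s }
  where
  diagonal = (true , true , true) , s

zeroSum-onPair : ∀ {S n u v} (χ : ℕ → Fin 3) → InRange n u → InRange n v →
  χ u ≡ χ v → OnPair S u v → ZeroSumSolution S n χ
zeroSum-onPair {n = n} {u} {v} χ ru rv χu≡χv ((i , j , k) , s) =
  pick i , pick j , pick k , range i , range j , range k , s , sum≡0
  where
  pick : Bool → ℕ
  pick b = if b then u else v
  range : ∀ b → InRange n (pick b)
  range true = ru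
  range false = rv
  colour : ∀ b → χ (pick b) ≡ χ u
  colour true = refl
  colour false = sym χu≡χv
  sum≡0 : ColourSum≡0 (χ (pick i)) (χ (pick j)) (χ (pick k))
  sum≡0 rewrite colour i | colour j | colour k = triple-sum (toℕ (χ u))

zeroSum-covering : ∀ {S n u v w} → Covering S u v w →
  InRange n u → InRange n v → InRange n w → ZeroSumFor S n
zeroSum-covering {u = u} {v} {w} cov ru rv rw χ with pigeonhole₃ (χ u) (χ v) (χ w)
... | inj₁ χu≡χv = zeroSum-onPair χ ru rv χu≡χv (Covering.on-uv cov)
... | inj₂ (inj₁ χv≡χw) = zeroSum-onPair χ rv rw χv≡χw (Covering.on-vw cov)
... | inj₂ (inj₂ (inj₁ χu≡χw)) = zeroSum-onPair χ ru rw χu≡χw (Covering.on-uw cov)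
... | inj₂ (inj₂ (inj₂ sum≡0)) = u , v , w , ru , rv , rw , Covering.uvw cov , sum≡0

isRamsey-between : ∀ {P : ℕ → Set} {N} → 1 ≤ N →
  (∀ n → N ≤ n → P n) → (∀ n → n ℕ.< N → ¬ P n) → IsRamsey P N
isRamsey-between 1≤N above below =
  1≤N , above , λ M _ P≥M → ℕ.≮⇒≥ λ M<N → below M M<N (P≥M M ℕ.≤-refl)

bothRamsey-threshold : ∀ S {m M u v w} → SolutionFree S 1 m → SolutionFree S m M →
  Covering S u v w → InRange M u → InRange M v → InRange M w → BothRamsey S M
bothRamsey-threshold S {M = M} free₁ free₂ cov ru@(1≤u , u≤M) rv rw =
  isRamsey-between 1≤M (λ n M≤n → zeroSum⇒mono (zeroSum n M≤n)) noMono ,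
  isRamsey-between 1≤M zeroSum (λ n n<M → noMono n n<M ∘ zeroSum⇒mono)
  where
  1≤M : 1 ≤ M
  1≤M = ℕ.≤-trans 1≤u u≤M
  widen : ∀ {n k} → M ≤ n → InRange M k → InRange n k
  widen M≤n (1≤k , k≤M) = 1≤k , ℕ.≤-trans k≤M M≤n
  zeroSum : ∀ n → M ≤ n → ZeroSumFor S n
  zeroSum n M≤n = zeroSum-covering cov (widen M≤n ru) (widen M≤n rv) (widen M≤n rw)
  noMono : ∀ n → n ℕ.< M → ¬ MonoFor S n
  noMono n n<M = no-mono-below free₁ free₂ n<M

-- Monotonicity of the linear form

Raises : ℤ → ℕ → ℕ → Set
Raises (+ _) x x′ = x ≤ x′
Raises -[1+ _ ] x x′ = x′ ≤ x

*-raises : ∀ a {x x′} → Raises a x x′ → a * + x ℤ.≤ a * + x′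
*-raises (+ n) x≤x′ = ℤ.*-monoˡ-≤-nonNeg (+ n) (+≤+ x≤x′)
*-raises -[1+ n ] x′≤x = ℤ.*-monoˡ-≤-nonPos -[1+ n ] (+≤+ x′≤x)

module LinearForm (a b c d : ℤ) where

  lhs : ℕ → ℕ → ℕ → ℤ
  lhs x y z = a * + x + b * + y + c * + z + d

  lhs-mono : ∀ {x y z x′ y′ z′} → Raises a x x′ → Raises b y y′ → Raises c z z′ →
    lhs x y z ℤ.≤ lhs x′ y′ z′
  lhs-mono rx ry rz =
    ℤ.+-monoˡ-≤ d (ℤ.+-mono-≤ (ℤ.+-mono-≤ (*-raises a rx) (*-raises b ry)) (*-raises c rz))

  L3-descends : ∀ x y z {x′ y′ z′} → Raises a x x′ → Raises b y y′ → Raises c z z′ →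
    L3 a b c d x′ y′ z′ → L3 a b c d x y z
  L3-descends _ _ _ rx ry rz = ℤ.≤-<-trans (lhs-mono rx ry rz)

  ¬L3-ascends : ∀ x y z {x′ y′ z′} → + 0 ℤ.≤ lhs x y z →
    Raises a x x′ → Raises b y y′ → Raises c z z′ → ¬ L3 a b c d x′ y′ z′
  ¬L3-ascends _ _ _ 0≤lhs rx ry rz = ℤ.≤⇒≯ (ℤ.≤-trans 0≤lhs (lhs-mono rx ry rz))

i<j⇒i-j<0 : ∀ {i j} → i < j → i - j < + 0
i<j⇒i-j<0 {i} {j} i<j = subst (i - j <_) (ℤ.+-inverseʳ j) (ℤ.+-monoˡ-< (- j) i<j)

record FloorDiv (e s : ℤ) : Set where
  field
    quot      : ℕ
    floorDiv≡ : floorDiv e s ≡ + quot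
    nonneg    : + 0 ℤ.≤ e - + quot * s
    neg       : e - + ℕ.suc quot * s < + 0

floorDiv-spec : ∀ {e s} → + 0 ℤ.≤ e → + 0 < s → FloorDiv e s
floorDiv-spec {s = + 0} _ (+<+ ())
floorDiv-spec {e} {+ ℕ.suc k} 0≤e _ =
  fromQuotient (e /ℕ ℕ.suc k) refl (0≤n⇒0≤n/ℕd e (ℕ.suc k) 0≤e)
    ([n/ℕd]*d≤n e (ℕ.suc k)) (n<s[n/ℕd]*d e (ℕ.suc k))
  where
  fromQuotient : ∀ q → e /ℕ ℕ.suc k ≡ q → + 0 ℤ.≤ q →
    q * + ℕ.suc k ℤ.≤ e → e < ℤ.suc q * + ℕ.suc k → FloorDiv e (+ ℕ.suc k)
  fromQuotient (+ q) eq _ q*s≤e e<[1+q]*s = record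
    { quot = q ; floorDiv≡ = eq ; nonneg = ℤ.i≤j⇒0≤j-i q*s≤e ; neg = i<j⇒i-j<0 e<[1+q]*s }

+suc : ∀ n → + ℕ.suc n ≡ + n + + 1
+suc n = cong +_ (ℕ.+-comm 1 n)

affine-mono : ∀ {e e′ s} t t′ → + 0 ℤ.≤ s → e ℤ.≤ e′ → t′ ≤ t →
  e - + t * s ℤ.≤ e′ - + t′ * s
affine-mono {s = + n} _ _ _ e≤e′ t′≤t =
  ℤ.+-mono-≤ e≤e′ (ℤ.neg-mono-≤ (ℤ.*-monoʳ-≤-nonNeg (+ n) (+≤+ t′≤t)))

twoStageValue : ℤ → ℤ → ℤ → ℤ
twoStageValue p d s = floorDiv (p * (floorDiv (p + d) s + + 1) + d) s + + 1

module TwoStage {p d s : ℤ} (0<s : + 0 < s) (0≤p : + 0 ℤ.≤ p) (0≤p+d : + 0 ℤ.≤ p + d) where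
  open FloorDiv

  0≤p*1+d : + 0 ℤ.≤ p * + 1 + d
  0≤p*1+d = subst (λ q → + 0 ℤ.≤ q + d) (sym (ℤ.*-identityʳ p)) 0≤p+d

  lower : FloorDiv (p * + 1 + d) s
  lower = floorDiv-spec 0≤p*1+d 0<s

  m : ℕ
  m = ℕ.suc (quot lower)

  p*1+d≤p*m+d : p * + 1 + d ℤ.≤ p * + m + d
  p*1+d≤p*m+d =
    ℤ.+-monoˡ-≤ d (ℤ.*-monoˡ-≤-nonNeg p {{ℤ.nonNegative 0≤p}} (+≤+ (ℕ.s≤s ℕ.z≤n)))

  upper : FloorDiv (p * + m + d) s
  upper = floorDiv-spec (ℤ.≤-trans 0≤p*1+d p*1+d≤p*m+d) 0<s

  M : ℕ
  M = ℕ.suc (quot upper)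

  m≤M : m ≤ M
  m≤M = ℕ.≮⇒≥ λ M<m → ℤ.≤⇒≯
    (ℤ.≤-trans (nonneg lower)
      (affine-mono (quot lower) M (ℤ.<⇒≤ 0<s) p*1+d≤p*m+d (ℕ.≤-pred M<m)))
    (neg upper)

  M≡twoStageValue : + M ≡ twoStageValue p d s
  M≡twoStageValue = begin
    + M                                              ≡⟨ +suc (quot upper) ⟩
    + quot upper + + 1                               ≡⟨ cong (_+ + 1) (sym (floorDiv≡ upper)) ⟩
    floorDiv (p * + m + d) s + + 1                   ≡⟨ cong (λ q → floorDiv (p * q + d) s + + 1)
                                                             (+suc (quot lower)) ⟩
    floorDiv (p * (+ quot lower + + 1) + d) s + + 1  ≡⟨ cong (λ q → floorDiv (p * (q + + 1) + d) s + + 1)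
                                                             (sym floor₁≡) ⟩
    twoStageValue p d s                              ∎
    where
    open ≡-Reasoning
    floor₁≡ : floorDiv (p + d) s ≡ + quot lower
    floor₁≡ = trans (cong (λ q → floorDiv (q + d) s) (sym (ℤ.*-identityʳ p))) (floorDiv≡ lower)

-- The four sign patterns

0≤-split : ∀ {e σ s} → e ≡ σ + s → + 0 ℤ.≤ σ → + 0 < s → + 0 ℤ.≤ e
0≤-split e≡σ+s 0≤σ 0<s = subst (+ 0 ℤ.≤_) (sym e≡σ+s) (ℤ.+-mono-≤ 0≤σ (ℤ.<⇒≤ 0<s))

lhs-ones : ∀ a b c d → a * + 1 + b * + 1 + c * + 1 + d ≡ a + b + c + d
lhs-ones = solve-∀

lhs-ttt : ∀ a b c d t → a * t + b * t + c * t + d ≡ d - t * (- a - b - c)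
lhs-ttt = solve-∀

lhs-ttu : ∀ a b c d t u → a * t + b * t + c * u + d ≡ (c * u + d) - t * (- a - b)
lhs-ttu = solve-∀

lhs-tuu : ∀ a b c d t u → a * t + b * u + c * u + d ≡ ((b + c) * u + d) - t * (- a)
lhs-tuu = solve-∀

d≡σ-a-b-c : ∀ a b c d → d ≡ (a + b + c + d) + (- a - b - c)
d≡σ-a-b-c = solve-∀

c+d≡σ-a-b : ∀ a b c d → c + d ≡ (a + b + c + d) + (- a - b)
c+d≡σ-a-b = solve-∀

b+c+d≡σ-a : ∀ a b c d → b + c + d ≡ (a + b + c + d) + (- a)
b+c+d≡σ-a = solve-∀

ramsey-σ<0 : ∀ {a b c d} → a + b + c + d < + 0 → BothRamsey (L3 a b c d) 1
ramsey-σ<0 {a} {b} {c} {d} σ<0 =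
  bothRamsey-threshold (L3 a b c d) (solutionFree-empty (L3 a b c d) 1)
    (solutionFree-empty (L3 a b c d) 1)
    (covering-diagonal (subst (_< + 0) (sym (lhs-ones a b c d)) σ<0)) r₁ r₁ r₁
  where
  r₁ : InRange 1 1
  r₁ = ℕ.≤-refl , ℕ.≤-refl

ramsey-neg³ : ∀ A B C d → let a = -[1+ A ] ; b = -[1+ B ] ; c = -[1+ C ] in
  + 0 ℤ.≤ a + b + c + d →
  Σ ℕ λ N → BothRamsey (L3 a b c d) N × + N ≡ floorDiv d (- a - b - c) + + 1
ramsey-neg³ A B C d 0≤σ =
  M , bothRamsey-threshold (L3 a b c d) free (solutionFree-empty (L3 a b c d) M)
        (covering-diagonal solution) rM rM rM ,
  trans (+suc quot) (cong (_+ + 1) (sym floorDiv≡))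
  where
  a b c s : ℤ
  a = -[1+ A ]
  b = -[1+ B ]
  c = -[1+ C ]
  s = - a - b - c
  open LinearForm a b c d
  0<s : + 0 < s
  0<s = +<+ (ℕ.s≤s ℕ.z≤n)
  floor : FloorDiv d s
  floor = floorDiv-spec (0≤-split (d≡σ-a-b-c a b c d) 0≤σ 0<s) 0<s
  open FloorDiv floor
  M : ℕ
  M = ℕ.suc quot
  rM : InRange M M
  rM = ℕ.s≤s ℕ.z≤n , ℕ.≤-refl
  solution : L3 a b c d M M M
  solution = subst (_< + 0) (sym (lhs-ttt a b c d (+ M))) neg
  free : SolutionFree (L3 a b c d) 1 M
  free _ _ _ x<M y<M z<M = ¬L3-ascends quot quot quot
    (subst (+ 0 ℤ.≤_) (sym (lhs-ttt a b c d (+ quot))) nonneg)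
    (ℕ.≤-pred x<M) (ℕ.≤-pred y<M) (ℕ.≤-pred z<M)

ramsey-neg²pos : ∀ A B C d → let a = -[1+ A ] ; b = -[1+ B ] ; c = + ℕ.suc C in
  + 0 ℤ.≤ a + b + c + d →
  Σ ℕ λ N → BothRamsey (L3 a b c d) N × + N ≡ twoStageValue c d (- a - b)
ramsey-neg²pos A B C d 0≤σ =
  M , bothRamsey-threshold (L3 a b c d) free₁ free₂ covering rM rm r₁ , M≡twoStageValue
  where
  a b c s : ℤ
  a = -[1+ A ]
  b = -[1+ B ]
  c = + ℕ.suc C
  s = - a - b
  open LinearForm a b c d
  0<s : + 0 < s
  0<s = +<+ (ℕ.s≤s ℕ.z≤n)
  open TwoStage {c} {d} 0<s (+≤+ ℕ.z≤n) (0≤-split (c+d≡σ-a-b a b c d) 0≤σ 0<s)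
  open FloorDiv
  1≤m : 1 ≤ m
  1≤m = ℕ.s≤s ℕ.z≤n
  r₁ : InRange M 1
  r₁ = ℕ.≤-refl , ℕ.≤-trans 1≤m m≤M
  rm : InRange M m
  rm = 1≤m , m≤M
  rM : InRange M M
  rM = ℕ.s≤s ℕ.z≤n , ℕ.≤-refl
  solution-mm1 : L3 a b c d m m 1
  solution-mm1 = subst (_< + 0) (sym (lhs-ttu a b c d (+ m) (+ 1))) (neg lower)
  solution-MMm : L3 a b c d M M m
  solution-MMm = subst (_< + 0) (sym (lhs-ttu a b c d (+ M) (+ m))) (neg upper)
  free₁ : SolutionFree (L3 a b c d) 1 m
  free₁ _ _ 1≤z x<m y<m _ = ¬L3-ascends (quot lower) (quot lower) 1
    (subst (+ 0 ℤ.≤_) (sym (lhs-ttu a b c d (+ quot lower) (+ 1))) (nonneg lower))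
    (ℕ.≤-pred x<m) (ℕ.≤-pred y<m) 1≤z
  free₂ : SolutionFree (L3 a b c d) m M
  free₂ _ _ m≤z x<M y<M _ = ¬L3-ascends (quot upper) (quot upper) m
    (subst (+ 0 ℤ.≤_) (sym (lhs-ttu a b c d (+ quot upper) (+ m))) (nonneg upper))
    (ℕ.≤-pred x<M) (ℕ.≤-pred y<M) m≤z
  covering : Covering (L3 a b c d) M m 1
  covering = record
    { on-uv = (true , true , false) , solution-MMm
    ; on-vw = (true , true , false) , solution-mm1
    ; on-uw = (true , true , false) , L3-descends M M 1 ℕ.≤-refl ℕ.≤-refl 1≤m solution-MMm
    ; uvw   = L3-descends M m 1 m≤M ℕ.≤-refl ℕ.≤-refl solution-mm1
    }

ramsey-negpos² : ∀ A B C d → let a = -[1+ A ] ; b = + ℕ.suc B ; c = + ℕ.suc C in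
  + 0 ℤ.≤ a + b + c + d →
  Σ ℕ λ N → BothRamsey (L3 a b c d) N × + N ≡ twoStageValue (b + c) d (- a)
ramsey-negpos² A B C d 0≤σ =
  M , bothRamsey-threshold (L3 a b c d) free₁ free₂ covering rM rm r₁ , M≡twoStageValue
  where
  a b c s : ℤ
  a = -[1+ A ]
  b = + ℕ.suc B
  c = + ℕ.suc C
  s = - a
  open LinearForm a b c d
  0<s : + 0 < s
  0<s = +<+ (ℕ.s≤s ℕ.z≤n)
  open TwoStage {b + c} {d} 0<s (+≤+ ℕ.z≤n) (0≤-split (b+c+d≡σ-a a b c d) 0≤σ 0<s)
  open FloorDiv
  1≤m : 1 ≤ m
  1≤m = ℕ.s≤s ℕ.z≤n
  r₁ : InRange M 1
  r₁ = ℕ.≤-refl , ℕ.≤-trans 1≤m m≤M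
  rm : InRange M m
  rm = 1≤m , m≤M
  rM : InRange M M
  rM = ℕ.s≤s ℕ.z≤n , ℕ.≤-refl
  solution-m11 : L3 a b c d m 1 1
  solution-m11 = subst (_< + 0) (sym (lhs-tuu a b c d (+ m) (+ 1))) (neg lower)
  solution-Mmm : L3 a b c d M m m
  solution-Mmm = subst (_< + 0) (sym (lhs-tuu a b c d (+ M) (+ m))) (neg upper)
  free₁ : SolutionFree (L3 a b c d) 1 m
  free₁ _ 1≤y 1≤z x<m _ _ = ¬L3-ascends (quot lower) 1 1
    (subst (+ 0 ℤ.≤_) (sym (lhs-tuu a b c d (+ quot lower) (+ 1))) (nonneg lower))
    (ℕ.≤-pred x<m) 1≤y 1≤z
  free₂ : SolutionFree (L3 a b c d) m M
  free₂ _ m≤y m≤z x<M _ _ = ¬L3-ascends (quot upper) m m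
    (subst (+ 0 ℤ.≤_) (sym (lhs-tuu a b c d (+ quot upper) (+ m))) (nonneg upper))
    (ℕ.≤-pred x<M) m≤y m≤z
  covering : Covering (L3 a b c d) M m 1
  covering = record
    { on-uv = (true , false , false) , solution-Mmm
    ; on-vw = (true , false , false) , solution-m11
    ; on-uw = (true , false , false) , L3-descends M 1 1 ℕ.≤-refl 1≤m 1≤m solution-Mmm
    ; uvw   = L3-descends M m 1 ℕ.≤-refl ℕ.≤-refl 1≤m solution-Mmm
    }

data SignPattern : ℤ → ℤ → ℤ → Set where
  neg³    : ∀ A B C → SignPattern -[1+ A ] -[1+ B ] -[1+ C ]
  neg²pos : ∀ A B C → SignPattern -[1+ A ] -[1+ B ] (+ ℕ.suc C)
  negpos² : ∀ A B C → SignPattern -[1+ A ] (+ ℕ.suc B) (+ ℕ.suc C)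
  pos³    : ∀ A B C → SignPattern (+ ℕ.suc A) (+ ℕ.suc B) (+ ℕ.suc C)

signPattern : ∀ {a b c} → a * b * c ≢ + 0 → a ℤ.≤ b → b ℤ.≤ c → SignPattern a b c
signPattern {a} {b} {+ 0} abc≢0 _ _ = contradiction (ℤ.*-zeroʳ (a * b)) abc≢0
signPattern { -[1+ _ ]} { -[1+ _ ]} { -[1+ _ ]} _ _ _ = neg³ _ _ _
signPattern {+ _} { -[1+ _ ]} _ () _
signPattern {_} {+ _} { -[1+ _ ]} _ _ ()
signPattern { -[1+ _ ]} { -[1+ _ ]} {+ ℕ.suc _} _ _ _ = neg²pos _ _ _
signPattern {a} {+ 0} {c@(+ ℕ.suc _)} abc≢0 _ _ =
  contradiction (cong (_* c) (ℤ.*-zeroʳ a)) abc≢0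
signPattern { -[1+ _ ]} {+ ℕ.suc _} {+ ℕ.suc _} _ _ _ = negpos² _ _ _
signPattern {+ 0} {+ ℕ.suc _} {+ ℕ.suc _} abc≢0 _ _ = contradiction refl abc≢0
signPattern {+ ℕ.suc _} {+ ℕ.suc _} {+ ℕ.suc _} _ _ _ = pos³ _ _ _

Solvable : (a b c d : ℤ) → Set
Solvable a b c d = Σ ℕ λ x → Σ ℕ λ y → Σ ℕ λ z → 1 ≤ x × 1 ≤ y × 1 ≤ z × L3 a b c d x y z

¬solvable-pos³ : ∀ A B C d → let a = + ℕ.suc A ; b = + ℕ.suc B ; c = + ℕ.suc C in
  + 0 ℤ.≤ a + b + c + d → ¬ Solvable a b c d
¬solvable-pos³ A B C d 0≤σ (_ , _ , _ , 1≤x , 1≤y , 1≤z , s) =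
  ¬L3-ascends 1 1 1 (subst (+ 0 ℤ.≤_) (sym (lhs-ones a b c d)) 0≤σ) 1≤x 1≤y 1≤z s
  where
  a b c : ℤ
  a = + ℕ.suc A
  b = + ℕ.suc B
  c = + ℕ.suc C
  open LinearForm a b c d

ClosedForm : (a b c d : ℤ) → ℕ → Set
ClosedForm a b c d N =
  (a + b + c + d < + 0 → + N ≡ + 1) ×
  (+ 0 ℤ.≤ a + b + c + d → c < + 0 → + N ≡ floorDiv d (- a - b - c) + + 1) ×
  (+ 0 ℤ.≤ a + b + c + d → b < + 0 → + 0 < c → + N ≡ twoStageValue c d (- a - b)) ×
  (+ 0 ℤ.≤ a + b + c + d → a < + 0 → + 0 < b → + N ≡ twoStageValue (b + c) d (- a))

RamseyAnswer : (a b c d : ℤ) → Set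
RamseyAnswer a b c d = Σ ℕ λ N →
  IsRamsey (MonoProp a b c d) N × IsRamsey (ZeroSumProp a b c d) N × ClosedForm a b c d N

answer-σ<0 : ∀ {a b c d} → a + b + c + d < + 0 → RamseyAnswer a b c d
answer-σ<0 {a} {b} {c} {d} σ<0 = let (mono , zeroSum) = ramsey-σ<0 {a} {b} {c} {d} σ<0 in
  1 , mono , zeroSum , (λ _ → refl) , (λ 0≤σ _ → absurd 0≤σ) ,
  (λ 0≤σ _ _ → absurd 0≤σ) , (λ 0≤σ _ _ → absurd 0≤σ)
  where
  absurd : ∀ {A : Set} → + 0 ℤ.≤ a + b + c + d → A
  absurd 0≤σ = contradiction σ<0 (ℤ.≤⇒≯ 0≤σ)

answer-σ≥0 : ∀ {a b c d} → SignPattern a b c → Solvable a b c d →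
  + 0 ℤ.≤ a + b + c + d → RamseyAnswer a b c d
answer-σ≥0 {d = d} (neg³ A B C) _ 0≤σ =
  let (N , (mono , zeroSum) , N≡) = ramsey-neg³ A B C d 0≤σ in
  N , mono , zeroSum , (λ σ<0 → contradiction σ<0 (ℤ.≤⇒≯ 0≤σ)) ,
  (λ _ _ → N≡) , (λ _ _ ()) , (λ _ _ ())
answer-σ≥0 {d = d} (neg²pos A B C) _ 0≤σ =
  let (N , (mono , zeroSum) , N≡) = ramsey-neg²pos A B C d 0≤σ in
  N , mono , zeroSum , (λ σ<0 → contradiction σ<0 (ℤ.≤⇒≯ 0≤σ)) ,
  (λ { _ (+<+ ()) }) , (λ _ _ _ → N≡) , (λ _ _ ())
answer-σ≥0 {d = d} (negpos² A B C) _ 0≤σ =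
  let (N , (mono , zeroSum) , N≡) = ramsey-negpos² A B C d 0≤σ in
  N , mono , zeroSum , (λ σ<0 → contradiction σ<0 (ℤ.≤⇒≯ 0≤σ)) ,
  (λ { _ (+<+ ()) }) , (λ { _ (+<+ ()) _ }) , (λ _ _ _ → N≡)
answer-σ≥0 {d = d} (pos³ A B C) solvable 0≤σ =
  contradiction solvable (¬solvable-pos³ A B C d 0≤σ)

theorem1 : (a b c d : ℤ) → a * b * c ≢ + 0 → a Data.Integer.≤ b → b Data.Integer.≤ c →
    (Σ ℕ λ x → Σ ℕ λ y → Σ ℕ λ z → 1 ≤ x × 1 ≤ y × 1 ≤ z × L3 a b c d x y z) →
    Σ ℕ λ N → IsRamsey (MonoProp a b c d) N × IsRamsey (ZeroSumProp a b c d) N ×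
      (a + b + c + d < + 0 → + N ≡ + 1) ×
      (+ 0 Data.Integer.≤ a + b + c + d → c < + 0 →
        + N ≡ floorDiv d (- a - b - c) + + 1) ×
      (+ 0 Data.Integer.≤ a + b + c + d → b < + 0 → + 0 < c →
        + N ≡ floorDiv (c * (floorDiv (c + d) (- a - b) + + 1) + d) (- a - b) + + 1) ×
      (+ 0 Data.Integer.≤ a + b + c + d → a < + 0 → + 0 < b →
        + N ≡ floorDiv ((b + c) * (floorDiv (b + c + d) (- a) + + 1) + d) (- a) + + 1)
theorem1 a b c d abc≢0 a≤b b≤c solvable with a + b + c + d ℤ.<? + 0
... | yes σ<0 = answer-σ<0 σ<0
... | no σ≮0 = answer-σ≥0 (signPattern abc≢0 a≤b b≤c) solvable (ℤ.≮⇒≥ σ≮0)
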